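{- Let $s,s'\in\{0,\dots,p-2\}$ and write $\iota(s)=(a,b)$, $\iota(s')=(a',b')$. Then $s+s'\equiv k_0-1\pmod{p-1}$ if and only if $a'=\{p-3-a\}$ and $b'=\{a+b+1\}$.
   Context: Let $p$ be an odd prime, $\mathcal O$ the ring of integers of a finite extension of $\mathbb Q_p$, $\Delta=\mathbb F_p^\times$ and $\omega:\Delta\to\mathcal O^\times$ the Teichmüller character. Fix a character $\varepsilon:\Delta^2\to\mathcal O^\times$ and write $\varepsilon=\varepsilon_1\times\varepsilon_1\omega^{k_0-2}$ with $k_0\in\{2,\dots,p\}$. For an integer $n$, $\{n\}\in\{0,\dots,p-2\}$ is its residue mod $p-1$. A pair $(a,b)$ with $0\le a,b\le p-2$ is $\varepsilon$-related if $\varepsilon(\bar\alpha,\bar\alpha)=\omega(\bar\alpha)^{a+2b}$ for all $\bar\alpha\in\Delta$. For $s\in\{0,\dots,p-2\}$, $\iota(s)$ denotes the unique $\varepsilon$-related pair $(a,b)$ with $0\le a,b\le p-2$ such that $\varepsilon=\omega^{ -s+b}\times\omega^{a+s+b}$. -}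

module Defs where

open import Data.Nat using (ℕ; zero; suc; _≤_; _∸_)
open import Data.Integer using (ℤ; +_; _-_; _+_; _*_; -_)
open import Data.Integer.DivMod using (_%ℕ_)
open import Data.Integer.Divisibility using (_∣_)
open import Data.Product using (_×_)

_≡_[mod_] : ℤ → ℤ → ℕ → Set
x ≡ y [mod n ] = (+ n) ∣ (x - y)

-- {x} : the residue of x modulo p-1, in {0,…,p-2}  (only meaningful for p ≥ 2).
res : ℕ → ℤ → ℕ
res (suc (suc m)) x = x %ℕ (suc m)
res _ _ = 0

-- Characters Δ → O^× are the powers ω^e of the Teichmüller character
-- (Δ is cyclic of order p-1 and ω generates its character group);
-- ω^x = ω^y iff x ≡ y mod p-1.  We encode ε = ε₁ × ε₁ω^(k₀-2) by the
-- exponent e₁ of ε₁ = ω^e₁ together with k₀, i.e.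
--   ε = ω^e₁ × ω^(e₁ + k₀ - 2).
εexp₁ : ℤ → ℕ → ℤ
εexp₁ e₁ k₀ = e₁

εexp₂ : ℤ → ℕ → ℤ
εexp₂ e₁ k₀ = e₁ + (+ k₀ - + 2)

-- (a,b) is ε-related: ε(α,α) = ω(α)^(a+2b) for all α, i.e.
-- ω^(e₁ + e₂) = ω^(a+2b).
εRelated : (p : ℕ) → ℤ → ℕ → ℕ → ℕ → Set
εRelated p e₁ k₀ a b =
  (εexp₁ e₁ k₀ + εexp₂ e₁ k₀) ≡ (+ a + + 2 * + b) [mod (p ∸ 1) ]

-- IsIota p e₁ k₀ s a b : (a,b) = ι(s), i.e. (a,b) is the ε-related pair with
-- 0 ≤ a,b ≤ p-2 and ε = ω^(-s+b) × ω^(a+s+b).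
IsIota : (p : ℕ) → ℤ → ℕ → ℕ → ℕ → ℕ → Set
IsIota p e₁ k₀ s a b =
  (a ≤ p ∸ 2) × (b ≤ p ∸ 2) × εRelated p e₁ k₀ a b ×
  (εexp₁ e₁ k₀ ≡ (- (+ s) + + b) [mod (p ∸ 1) ]) ×
  (εexp₂ e₁ k₀ ≡ (+ a + + s + + b) [mod (p ∸ 1) ])

{-# OPTIONS --safe #-}
-- Modulo p − 1 the two congruences defining ι(s) = (a, b) say b ≡ e₁ + s and
-- a ≡ k₀ − 2 − 2s, so ι is explicit.  For a second pair ι(s′) = (a′, b′) this gives
-- b′ − (a + b + 1) ≡ (s + s′) − (k₀ − 1), whence the equivalence for b′, and, when
-- s + s′ ≡ k₀ − 1, also a + a′ ≡ 2(k₀ − 2) − 2(s + s′) ≡ −2 ≡ p − 3.  Finally a residue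
-- in {0, …, p − 2} is determined by its class.
module Submission where

open import Defs
open import Data.Nat using (ℕ; _≤_; _∸_; _+_)
open import Data.Nat.Primality using (Prime)
open import Data.Nat.Divisibility using (_∣_)
open import Data.Integer using (ℤ; +_; _-_)
open import Data.Product using (_×_)
open import Relation.Binary.PropositionalEquality using (_≡_)
open import Relation.Nullary using (¬_)
open import Function.Bundles using (_⇔_)

open import Data.Nat using (suc; s≤s; _<_; NonZero)
open import Data.Nat.Properties using (⊔-lub; ≤-<-trans)
open import Data.Nat.DivMod using (m<n⇒m%n≡m)
open import Data.Nat.Divisibility using (n∣m⇒m%n≡0)
open import Data.Nat.Primality using (¬prime[0]; ¬prime[1])
open import Data.Integer as ℤ using (0ℤ; -_; _*_; ∣_∣)
open import Data.Integer.Properties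
  using (pos-+; +-injective; ∣i∣≡0⇒i≡0; i-j≡0⇒i≡j; [+m]-[+n]≡m⊖n; ∣m⊝n∣≤m⊔n;
         +-identityˡ; ∣i-j∣≡∣j-i∣)
open import Data.Integer.DivMod using (_%ℕ_; _/ℕ_; a≡a%ℕn+[a/ℕn]*n; n%ℕd<d)
open import Data.Integer.Divisibility.Signed as Signed
  using (∣ᵤ⇒∣; ∣⇒∣ᵤ; ∣m∣n⇒∣m+n; ∣m⇒∣-m; ∣n⇒∣m*n)
open import Data.Integer.Tactic.RingSolver using (solve-∀)
open import Data.Product using (_,_; proj₁; proj₂)
open import Data.Empty using (⊥-elim)
open import Function.Bundles using (mk⇔; Equivalence)
open import Function.Construct.Composition using (_⇔-∘_)
open import Level using (0ℓ)
open import Relation.Binary.Bundles using (Setoid)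
open import Relation.Binary.Structures using (IsEquivalence)
open import Relation.Binary.PropositionalEquality as ≡ using (refl; cong; subst)
import Relation.Binary.Reasoning.Setoid as SetoidReasoning

-- The congruence of Defs unfolds to a statement about ∣ x - y ∣, from which Agda
-- cannot infer x and y; this wrapper keeps them recoverable.
infix 4 _≈_[mod_]
record _≈_[mod_] (x y : ℤ) (n : ℕ) : Set where
  constructor wrap
  field unwrap : x ≡ y [mod n ]
open _≈_[mod_]

module _ {n : ℕ} where

  ≈-mod⇒∣ : ∀ {x y} → x ≈ y [mod n ] → (+ n) Signed.∣ (x - y)
  ≈-mod⇒∣ {x} {y} (wrap x≡y) = ∣ᵤ⇒∣ {+ n} {x - y} x≡y

  ∣⇒≈-mod : ∀ {d x y} → d ≡ x - y → (+ n) Signed.∣ d → x ≈ y [mod n ]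
  ∣⇒≈-mod refl n∣d = wrap (∣⇒∣ᵤ n∣d)

  ≈-mod-reflexive : ∀ {x y} → x ≡ y → x ≈ y [mod n ]
  ≈-mod-reflexive {x} refl = ∣⇒≈-mod refl (Signed.divides 0ℤ (x-x≡0 x))
    where
    x-x≡0 : ∀ x → x - x ≡ 0ℤ * + n
    x-x≡0 = solve-∀

  ≈-mod-sym : ∀ {x y} → x ≈ y [mod n ] → y ≈ x [mod n ]
  ≈-mod-sym {x} {y} (wrap x≡y) = wrap (subst (n ∣_) (∣i-j∣≡∣j-i∣ x y) x≡y)

  ≈-mod-trans : ∀ {x y z} → x ≈ y [mod n ] → y ≈ z [mod n ] → x ≈ z [mod n ]
  ≈-mod-trans {x} {y} {z} x≈y y≈z =
    ∣⇒≈-mod (telescope x y z) (∣m∣n⇒∣m+n (≈-mod⇒∣ x≈y) (≈-mod⇒∣ y≈z))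
    where
    telescope : ∀ x y z → (x - y) ℤ.+ (y - z) ≡ x - z
    telescope = solve-∀

  ≈-mod-refl : ∀ {x} → x ≈ x [mod n ]
  ≈-mod-refl = ≈-mod-reflexive refl

  ≈-mod-isEquivalence : IsEquivalence (_≈_[mod n ])
  ≈-mod-isEquivalence = record
    { refl  = ≈-mod-refl
    ; sym   = ≈-mod-sym
    ; trans = ≈-mod-trans
    }

  +-cong-mod : ∀ {x y u v} → x ≈ y [mod n ] → u ≈ v [mod n ] → x ℤ.+ u ≈ y ℤ.+ v [mod n ]
  +-cong-mod {x} {y} {u} {v} x≈y u≈v =
    ∣⇒≈-mod (interchange x y u v) (∣m∣n⇒∣m+n (≈-mod⇒∣ x≈y) (≈-mod⇒∣ u≈v))
    where
    interchange : ∀ x y u v → (x - y) ℤ.+ (u - v) ≡ (x ℤ.+ u) - (y ℤ.+ v)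
    interchange = solve-∀

  -‿cong-mod : ∀ {x y} → x ≈ y [mod n ] → - x ≈ - y [mod n ]
  -‿cong-mod {x} {y} x≈y = ∣⇒≈-mod (negate x y) (∣m⇒∣-m (≈-mod⇒∣ x≈y))
    where
    negate : ∀ x y → - (x - y) ≡ - x - - y
    negate = solve-∀

  *-congˡ-mod : ∀ c {x y} → x ≈ y [mod n ] → c * x ≈ c * y [mod n ]
  *-congˡ-mod c {x} {y} x≈y = ∣⇒≈-mod (scale c x y) (∣n⇒∣m*n c (≈-mod⇒∣ x≈y))
    where
    scale : ∀ c x y → c * (x - y) ≡ c * x - c * y
    scale = solve-∀

  +-congˡ-mod-⇔ : ∀ c {x y} → x ≈ y [mod n ] ⇔ c ℤ.+ x ≈ c ℤ.+ y [mod n ]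
  +-congˡ-mod-⇔ c {x} {y} = mk⇔ (λ x≈y → ∣⇒≈-mod (shift c x y) (≈-mod⇒∣ x≈y))
                                 (λ c+x≈c+y → ∣⇒≈-mod (≡.sym (shift c x y)) (≈-mod⇒∣ c+x≈c+y))
    where
    shift : ∀ c x y → x - y ≡ (c ℤ.+ x) - (c ℤ.+ y)
    shift = solve-∀

  ≈-mod-resp-⇔ : ∀ {x x′ y y′} → x ≈ x′ [mod n ] → y ≈ y′ [mod n ] →
                 x ≈ y [mod n ] ⇔ x′ ≈ y′ [mod n ]
  ≈-mod-resp-⇔ x≈x′ y≈y′ =
    mk⇔ (λ x≈y → ≈-mod-trans (≈-mod-sym x≈x′) (≈-mod-trans x≈y y≈y′))
        (λ x′≈y′ → ≈-mod-trans x≈x′ (≈-mod-trans x′≈y′ (≈-mod-sym y≈y′)))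

  n≈0-mod : + n ≈ 0ℤ [mod n ]
  n≈0-mod = ∣⇒≈-mod refl (Signed.divides (+ 1) (n-0≡1*n (+ n)))
    where
    n-0≡1*n : ∀ m → m - 0ℤ ≡ + 1 * m
    n-0≡1*n = solve-∀

≈-mod-setoid : ℕ → Setoid 0ℓ 0ℓ
≈-mod-setoid n = record { isEquivalence = ≈-mod-isEquivalence {n} }

≈-mod⇒≡ : ∀ {n} .{{_ : NonZero n}} {r r′} → r < n → r′ < n → + r ≈ + r′ [mod n ] → r ≡ r′
≈-mod⇒≡ {n} {r} {r′} r<n r′<n (wrap n∣∣r-r′∣) =
  +-injective (i-j≡0⇒i≡j (+ r) (+ r′) (∣i∣≡0⇒i≡0 ∣r-r′∣≡0))
  where
  ∣r-r′∣<n : ∣ + r - + r′ ∣ < n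
  ∣r-r′∣<n = subst (_< n) (cong ∣_∣ (≡.sym ([+m]-[+n]≡m⊖n r r′)))
                   (≤-<-trans (∣m⊝n∣≤m⊔n r r′) (⊔-lub r<n r′<n))
  ∣r-r′∣≡0 : ∣ + r - + r′ ∣ ≡ 0
  ∣r-r′∣≡0 = ≡.trans (≡.sym (m<n⇒m%n≡m ∣r-r′∣<n)) (n∣m⇒m%n≡0 _ n n∣∣r-r′∣)

%ℕ-≈-mod : ∀ x n .{{_ : NonZero n}} → + (x %ℕ n) ≈ x [mod n ]
%ℕ-≈-mod x n = ∣⇒≈-mod refl (Signed.divides (- q) r-x≡-q*n)
  where
  r : ℤ
  r = + (x %ℕ n)
  q : ℤ
  q = x /ℕ n
  cancel : ∀ r q m → r - (r ℤ.+ q * m) ≡ - q * m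
  cancel = solve-∀
  r-x≡-q*n : r - x ≡ - q * + n
  r-x≡-q*n = ≡.trans (cong (λ y → r - y) (a≡a%ℕn+[a/ℕn]*n x n)) (cancel r q (+ n))

≡-%ℕ⇔≈-mod : ∀ {n} .{{_ : NonZero n}} {r} x → r < n → r ≡ x %ℕ n ⇔ + r ≈ x [mod n ]
≡-%ℕ⇔≈-mod {n} x r<n = mk⇔
  (λ r≡x%n → ≈-mod-trans (≈-mod-reflexive (cong +_ r≡x%n)) (%ℕ-≈-mod x n))
  (λ r≈x → ≈-mod⇒≡ r<n (n%ℕd<d x n) (≈-mod-trans r≈x (≈-mod-sym (%ℕ-≈-mod x n))))

module IsIota-congruences {p : ℕ} {e₁ : ℤ} {k₀ s a b : ℕ} (ι : IsIota p e₁ k₀ s a b) where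
  open SetoidReasoning (≈-mod-setoid (p ∸ 1))

  private
    b-s≈e₁ : - (+ s) ℤ.+ + b ≈ e₁ [mod p ∸ 1 ]
    b-s≈e₁ = ≈-mod-sym (wrap (proj₁ (proj₂ (proj₂ (proj₂ ι)))))
    a+s+b≈e₂ : + a ℤ.+ + s ℤ.+ + b ≈ e₁ ℤ.+ (+ k₀ - + 2) [mod p ∸ 1 ]
    a+s+b≈e₂ = ≈-mod-sym (wrap (proj₂ (proj₂ (proj₂ (proj₂ ι)))))

  b≈e₁+s : + b ≈ e₁ ℤ.+ + s [mod p ∸ 1 ]
  b≈e₁+s = begin
    + b                          ≡⟨ isolate-b (+ s) (+ b) ⟨
    (- (+ s) ℤ.+ + b) ℤ.+ + s    ≈⟨ +-cong-mod b-s≈e₁ (≈-mod-refl {x = + s}) ⟩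
    e₁ ℤ.+ + s                   ∎
    where
    isolate-b : ∀ s b → (- s ℤ.+ b) ℤ.+ s ≡ b
    isolate-b = solve-∀

  a≈k₀-2-2s : + a ≈ (+ k₀ - + 2) - + 2 * + s [mod p ∸ 1 ]
  a≈k₀-2-2s = begin
    + a                                            ≡⟨ isolate-a (+ a) (+ s) (+ b) ⟨
    ((+ a ℤ.+ + s ℤ.+ + b) - + s) - + b            ≈⟨ +-cong-mod (+-cong-mod a+s+b≈e₂ (≈-mod-refl {x = - (+ s)}))
                                                                 (-‿cong-mod b≈e₁+s) ⟩
    ((e₁ ℤ.+ (+ k₀ - + 2)) - + s) - (e₁ ℤ.+ + s)   ≡⟨ eliminate-e₁ e₁ (+ k₀) (+ s) ⟩
    (+ k₀ - + 2) - + 2 * + s                       ∎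
    where
    isolate-a : ∀ a s b → ((a ℤ.+ s ℤ.+ b) - s) - b ≡ a
    isolate-a = solve-∀
    eliminate-e₁ : ∀ e k s → ((e ℤ.+ (k - + 2)) - s) - (e ℤ.+ s) ≡ (k - + 2) - + 2 * s
    eliminate-e₁ = solve-∀

module IsIota-pair {n : ℕ} {e₁ : ℤ} {k₀ s s′ a b a′ b′ : ℕ}
         (ι : IsIota (suc n) e₁ k₀ s a b) (ι′ : IsIota (suc n) e₁ k₀ s′ a′ b′) where
  open SetoidReasoning (≈-mod-setoid n)
  private module ι = IsIota-congruences {suc n} {e₁} {k₀} {s} {a} {b} ι
  private module ι′ = IsIota-congruences {suc n} {e₁} {k₀} {s′} {a′} {b′} ι′

  s+s′≈k₀-1⇔b′≈a+b+1 : + (s + s′) ≈ + k₀ - + 1 [mod n ] ⇔ + b′ ≈ + (a + b + 1) [mod n ]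
  s+s′≈k₀-1⇔b′≈a+b+1 = ≈-mod-resp-⇔ shifted-s+s′ shifted-k₀-1 ⇔-∘ +-congˡ-mod-⇔ (e₁ - + s)
    where
    cancel-s : ∀ e s s′ → (e - s) ℤ.+ (s ℤ.+ s′) ≡ e ℤ.+ s′
    cancel-s = solve-∀
    regroup : ∀ e k s → ((k - + 2) - + 2 * s) ℤ.+ (e ℤ.+ s) ℤ.+ + 1 ≡ (e - s) ℤ.+ (k - + 1)
    regroup = solve-∀
    shifted-s+s′ : (e₁ - + s) ℤ.+ + (s + s′) ≈ + b′ [mod n ]
    shifted-s+s′ = begin
      (e₁ - + s) ℤ.+ + (s + s′)      ≡⟨ cong (λ t → (e₁ - + s) ℤ.+ t) (pos-+ s s′) ⟩
      (e₁ - + s) ℤ.+ (+ s ℤ.+ + s′)  ≡⟨ cancel-s e₁ (+ s) (+ s′) ⟩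
      e₁ ℤ.+ + s′                    ≈⟨ ι′.b≈e₁+s ⟨
      + b′                           ∎
    shifted-k₀-1 : (e₁ - + s) ℤ.+ (+ k₀ - + 1) ≈ + (a + b + 1) [mod n ]
    shifted-k₀-1 = begin
      (e₁ - + s) ℤ.+ (+ k₀ - + 1)                          ≡⟨ regroup e₁ (+ k₀) (+ s) ⟨
      ((+ k₀ - + 2) - + 2 * + s) ℤ.+ (e₁ ℤ.+ + s) ℤ.+ + 1  ≈⟨ +-cong-mod (+-cong-mod ι.a≈k₀-2-2s ι.b≈e₁+s)
                                                                        (≈-mod-refl {x = + 1}) ⟨
      + a ℤ.+ + b ℤ.+ + 1                                  ≡⟨ cong (λ t → t ℤ.+ + 1) (pos-+ a b) ⟨
      + (a + b) ℤ.+ + 1                                    ≡⟨ pos-+ (a + b) 1 ⟨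
      + (a + b + 1)                                        ∎

  s+s′≈k₀-1⇒a′≈p-3-a : + (s + s′) ≈ + k₀ - + 1 [mod n ] → + a′ ≈ + suc n - + 3 - + a [mod n ]
  s+s′≈k₀-1⇒a′≈p-3-a s+s′≈k₀-1 = begin
    + a′                                                ≈⟨ ι′.a≈k₀-2-2s ⟩
    (+ k₀ - + 2) - + 2 * + s′                           ≡⟨ trade-s′ ⟩
    ((+ k₀ - + 2) ℤ.+ + 2 * + s) - + 2 * + (s + s′)     ≈⟨ +-cong-mod (≈-mod-refl {x = (+ k₀ - + 2) ℤ.+ + 2 * + s})
                                                                      (-‿cong-mod (*-congˡ-mod (+ 2) s+s′≈k₀-1)) ⟩
    ((+ k₀ - + 2) ℤ.+ + 2 * + s) - + 2 * (+ k₀ - + 1)   ≡⟨ collect (+ k₀) (+ s) ⟩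
    - (+ 2) - ((+ k₀ - + 2) - + 2 * + s)                ≈⟨ +-cong-mod (≈-mod-refl {x = - (+ 2)})
                                                                      (-‿cong-mod ι.a≈k₀-2-2s) ⟨
    - (+ 2) - + a                                       ≡⟨ +-identityˡ (- (+ 2) - + a) ⟨
    0ℤ ℤ.+ (- (+ 2) - + a)                              ≈⟨ +-cong-mod n≈0-mod (≈-mod-refl {x = - (+ 2) - + a}) ⟨
    + n ℤ.+ (- (+ 2) - + a)                             ≡⟨ unfold-p ⟨
    + suc n - + 3 - + a                                 ∎
    where
    add-2s : ∀ k s s′ → (k - + 2) - + 2 * s′ ≡ ((k - + 2) ℤ.+ + 2 * s) - + 2 * (s ℤ.+ s′)
    add-2s = solve-∀
    trade-s′ : (+ k₀ - + 2) - + 2 * + s′ ≡ ((+ k₀ - + 2) ℤ.+ + 2 * + s) - + 2 * + (s + s′)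
    trade-s′ = ≡.trans (add-2s (+ k₀) (+ s) (+ s′))
                       (cong (λ t → ((+ k₀ - + 2) ℤ.+ + 2 * + s) - + 2 * t) (≡.sym (pos-+ s s′)))
    collect : ∀ k s → ((k - + 2) ℤ.+ + 2 * s) - + 2 * (k - + 1) ≡ - (+ 2) - ((k - + 2) - + 2 * s)
    collect = solve-∀
    shift-p : ∀ m a → (+ 1 ℤ.+ m) - + 3 - a ≡ m ℤ.+ (- (+ 2) - a)
    shift-p = solve-∀
    unfold-p : + suc n - + 3 - + a ≡ + n ℤ.+ (- (+ 2) - + a)
    unfold-p = ≡.trans (cong (λ t → t - + 3 - + a) (pos-+ 1 n)) (shift-p (+ n) (+ a))

lemma3p4 : (p : ℕ) → Prime p → ¬ (2 ∣ p) →
    (e₁ : ℤ) (k₀ : ℕ) → 2 ≤ k₀ → k₀ ≤ p →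
    (s s′ a b a′ b′ : ℕ) → s ≤ p ∸ 2 → s′ ≤ p ∸ 2 →
    IsIota p e₁ k₀ s a b → IsIota p e₁ k₀ s′ a′ b′ →
    ((+ (s + s′)) ≡ (+ k₀ - + 1) [mod (p ∸ 1) ] ⇔
      ((a′ ≡ res p (+ p - + 3 - + a)) × (b′ ≡ res p (+ (a + b + 1)))))
lemma3p4 0 p-prime _ = ⊥-elim (¬prime[0] p-prime)
lemma3p4 1 p-prime _ = ⊥-elim (¬prime[1] p-prime)
lemma3p4 p@(suc (suc m)) _ _ e₁ k₀ _ _ s s′ a b a′ b′ _ _ ι ι′@(a′≤m , b′≤m , _) = mk⇔
  (λ s+s′≡k₀-1 →
      Equivalence.from (≡-%ℕ⇔≈-mod (+ p - + 3 - + a) (s≤s a′≤m))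
        (s+s′≈k₀-1⇒a′≈p-3-a (wrap s+s′≡k₀-1))
    , Equivalence.from (≡-%ℕ⇔≈-mod (+ (a + b + 1)) (s≤s b′≤m))
        (Equivalence.to s+s′≈k₀-1⇔b′≈a+b+1 (wrap s+s′≡k₀-1)))
  (λ (_ , b′≡res) →
      unwrap (Equivalence.from s+s′≈k₀-1⇔b′≈a+b+1
        (Equivalence.to (≡-%ℕ⇔≈-mod (+ (a + b + 1)) (s≤s b′≤m)) b′≡res)))
  where
  open IsIota-pair {suc m} {e₁} {k₀} {s} {s′} {a} {b} {a′} {b′} ι ι′
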